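{- Let $(\mathbb{X},\dagger)$ be a Moore-Penrose dagger category. Then the dagger idempotent splitting completion $(\mathsf{Split}_\dagger(\mathbb{X}),\dagger)$ is Moore-Penrose complete.
   Context: Composition is in diagrammatic order. A dagger category is a category with an identity-on-objects contravariant involutive functor $\dagger$. A Moore-Penrose inverse of $f: A\to B$ is $f^\circ: B\to A$ with $ff^\circ f = f$, $f^\circ f f^\circ = f^\circ$, $(ff^\circ)^\dagger = ff^\circ$, $(f^\circ f)^\dagger = f^\circ f$; a dagger category is Moore-Penrose if every map has one. A $\dagger$-idempotent is $e: A\to A$ with $ee=e=e^\dagger$; it $\dagger$-splits if $e = rr^\dagger$ for some $r: A\to X$ with $r^\dagger r = 1_X$. A map is Moore-Penrose split if it has a Moore-Penrose inverse $f^\circ$ and $ff^\circ$, $f^\circ f$ both $\dagger$-split; a dagger category is Moore-Penrose complete if every map is Moore-Penrose split. $\mathsf{Split}_\dagger(\mathbb{X})$ has objects pairs $(A,e)$ with $e$ a $\dagger$-idempotent on $A$ in $\mathbb{X}$; maps $f: (A_1,e_1)\to(A_2,e_2)$ are maps $f: A_1\to A_2$ of $\mathbb{X}$ with $e_1 f e_2 = f$; composition and dagger are as in $\mathbb{X}$, and the identity on $(A,e)$ is $e$. -}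

module Defs where

open import Level using (Level; _⊔_; suc)
open import Data.Product using (Σ; Σ-syntax; _×_; _,_; proj₁; proj₂)
open import Relation.Binary using (IsEquivalence)
import Relation.Binary.Reasoning.Setoid

-- A category with setoid-valued hom-sets, composition written in
-- DIAGRAMMATIC order:  f ∘ g  means "first f, then g".
record Category (o m e : Level) : Set (suc (o ⊔ m ⊔ e)) where
  infixr 9 _∘_
  infix 4 _≈_
  field
    Obj   : Set o
    Hom   : Obj → Obj → Set m
    _≈_   : ∀ {A B} → Hom A B → Hom A B → Set e
    ≈-equiv : ∀ {A B} → IsEquivalence (_≈_ {A} {B})
    id    : ∀ {A} → Hom A A
    _∘_   : ∀ {A B C} → Hom A B → Hom B C → Hom A C
    ∘-cong : ∀ {A B C} {f f' : Hom A B} {g g' : Hom B C} →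
             f ≈ f' → g ≈ g' → f ∘ g ≈ f' ∘ g'
    idˡ   : ∀ {A B} (f : Hom A B) → id ∘ f ≈ f
    idʳ   : ∀ {A B} (f : Hom A B) → f ∘ id ≈ f
    assoc : ∀ {A B C D} (f : Hom A B) (g : Hom B C) (h : Hom C D) →
            (f ∘ g) ∘ h ≈ f ∘ (g ∘ h)

record DaggerCategory (o m e : Level) : Set (suc (o ⊔ m ⊔ e)) where
  field
    cat : Category o m e
  open Category cat public
  field
    _† : ∀ {A B} → Hom A B → Hom B A
    †-cong : ∀ {A B} {f g : Hom A B} → f ≈ g → (f †) ≈ (g †)
    †-id   : ∀ {A} → (id {A} †) ≈ id
    †-∘    : ∀ {A B C} (f : Hom A B) (g : Hom B C) → ((f ∘ g) †) ≈ (g †) ∘ (f †)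
    †-inv  : ∀ {A B} (f : Hom A B) → ((f †) †) ≈ f

module _ {o m e : Level} (𝕏 : DaggerCategory o m e) where
  open DaggerCategory 𝕏

  IsMPInverse : ∀ {A B} → Hom A B → Hom B A → Set e
  IsMPInverse f g =
    (f ∘ g ∘ f ≈ f) × (g ∘ f ∘ g ≈ g) ×
    (((f ∘ g) †) ≈ f ∘ g) × (((g ∘ f) †) ≈ g ∘ f)

  HasMPInverse : ∀ {A B} → Hom A B → Set (m ⊔ e)
  HasMPInverse {A} {B} f = Σ[ g ∈ Hom B A ] IsMPInverse f g

  IsMoorePenrose : Set (o ⊔ m ⊔ e)
  IsMoorePenrose = ∀ {A B} (f : Hom A B) → HasMPInverse f

  IsDaggerIdempotent : ∀ {A} → Hom A A → Set e
  IsDaggerIdempotent i = (i ∘ i ≈ i) × ((i †) ≈ i)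

  DaggerSplits : ∀ {A} → Hom A A → Set (o ⊔ m ⊔ e)
  DaggerSplits {A} i = Σ[ X ∈ Obj ] Σ[ r ∈ Hom A X ] ((i ≈ r ∘ (r †)) × ((r †) ∘ r ≈ id))

  MoorePenroseSplit : ∀ {A B} → Hom A B → Set (o ⊔ m ⊔ e)
  MoorePenroseSplit {A} {B} f =
    Σ[ g ∈ Hom B A ] (IsMPInverse f g × DaggerSplits (f ∘ g) × DaggerSplits (g ∘ f))

  IsMoorePenroseComplete : Set (o ⊔ m ⊔ e)
  IsMoorePenroseComplete = ∀ {A B} (f : Hom A B) → MoorePenroseSplit f

module _ {o m e : Level} (𝕏 : DaggerCategory o m e) where
  open DaggerCategory 𝕏
  private
    module E {A B : Obj} = IsEquivalence (≈-equiv {A} {B})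

  SObj : Set (o ⊔ m ⊔ e)
  SObj = Σ[ A ∈ Obj ] Σ[ i ∈ Hom A A ] IsDaggerIdempotent 𝕏 i

  SHom : SObj → SObj → Set (m ⊔ e)
  SHom (A₁ , e₁ , _) (A₂ , e₂ , _) = Σ[ f ∈ Hom A₁ A₂ ] (e₁ ∘ f ∘ e₂ ≈ f)

  private
    open import Relation.Binary using (Setoid)
    module SR = Relation.Binary.Reasoning.Setoid
    hs : Obj → Obj → Setoid m e
    hs A B = record { Carrier = Hom A B ; _≈_ = _≈_ ; isEquivalence = ≈-equiv }

    sid : ∀ {X} → SHom X X
    sid {A , i , ii , i†} = i , E.trans (∘-cong E.refl ii) ii

    lcancel : ∀ {A B} {i : Hom A A} {j : Hom B B} → i ∘ i ≈ i → (f : Hom A B) →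
              i ∘ f ∘ j ≈ f → i ∘ f ≈ f
    lcancel {i = i} {j} ii f p = begin
        i ∘ f                 ≈⟨ ∘-cong E.refl (E.sym p) ⟩
        i ∘ (i ∘ f ∘ j)       ≈⟨ E.sym (assoc i i (f ∘ j)) ⟩
        (i ∘ i) ∘ (f ∘ j)     ≈⟨ ∘-cong ii E.refl ⟩
        i ∘ f ∘ j             ≈⟨ p ⟩
        f ∎
      where open SR (hs _ _)

    rcancel : ∀ {A B} {i : Hom A A} {j : Hom B B} → j ∘ j ≈ j → (f : Hom A B) →
              i ∘ f ∘ j ≈ f → f ∘ j ≈ f
    rcancel {i = i} {j} jj f p = begin
        f ∘ j                 ≈⟨ ∘-cong (E.sym p) E.refl ⟩
        (i ∘ f ∘ j) ∘ j       ≈⟨ assoc i (f ∘ j) j ⟩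
        i ∘ ((f ∘ j) ∘ j)     ≈⟨ ∘-cong E.refl (assoc f j j) ⟩
        i ∘ f ∘ (j ∘ j)       ≈⟨ ∘-cong E.refl (∘-cong E.refl jj) ⟩
        i ∘ f ∘ j             ≈⟨ p ⟩
        f ∎
      where open SR (hs _ _)

  scomp : ∀ {X Y Z} → SHom X Y → SHom Y Z → SHom X Z
  scomp {A₁ , e₁ , e₁e₁ , _} {A₂ , e₂ , _} {A₃ , e₃ , e₃e₃ , _} (f , pf) (g , pg) =
    f ∘ g , (begin
      e₁ ∘ (f ∘ g) ∘ e₃     ≈⟨ ∘-cong E.refl (assoc f g e₃) ⟩
      e₁ ∘ f ∘ (g ∘ e₃)     ≈⟨ E.sym (assoc e₁ f (g ∘ e₃)) ⟩
      (e₁ ∘ f) ∘ (g ∘ e₃)   ≈⟨ ∘-cong (lcancel e₁e₁ f pf) (rcancel e₃e₃ g pg) ⟩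
      f ∘ g ∎)
    where open SR (hs _ _)

  _≈S_ : ∀ {X Y} → SHom X Y → SHom X Y → Set e
  f ≈S g = proj₁ f ≈ proj₁ g

  Split† : DaggerCategory (o ⊔ m ⊔ e) (m ⊔ e) e
  Split† = record
    { cat = record
      { Obj = SObj
      ; Hom = SHom
      ; _≈_ = λ {X} {Y} → _≈S_ {X} {Y}
      ; ≈-equiv = record { refl = E.refl ; sym = E.sym ; trans = E.trans }
      ; id = λ {X} → sid {X}
      ; _∘_ = λ {X} {Y} {Z} → scomp {X} {Y} {Z}
      ; ∘-cong = ∘-cong
      ; idˡ = λ { {A , i , ii , _} {B , j , _} (f , p) → lcancel {j = j} ii f p }
      ; idʳ = λ { {A , i , _} {B , j , jj , _} (f , p) → rcancel {i = i} jj f p }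
      ; assoc = λ f g h → assoc (proj₁ f) (proj₁ g) (proj₁ h)
      }
    ; _† = λ {X} {Y} → s† {X} {Y}
    ; †-cong = †-cong
    ; †-id = λ { {A , i , _ , i†} → i† }
    ; †-∘ = λ f g → †-∘ (proj₁ f) (proj₁ g)
    ; †-inv = λ f → †-inv (proj₁ f)
    }
    where
    s† : ∀ {X Y} → SHom X Y → SHom Y X
    s† {A₁ , e₁ , _ , e₁†} {A₂ , e₂ , _ , e₂†} (f , p) =
      (f †) , (begin
        e₂ ∘ (f †) ∘ e₁            ≈⟨ ∘-cong (E.sym e₂†) (∘-cong E.refl (E.sym e₁†)) ⟩
        (e₂ †) ∘ (f †) ∘ (e₁ †)    ≈⟨ ∘-cong E.refl (E.sym (†-∘ e₁ f)) ⟩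
        (e₂ †) ∘ ((e₁ ∘ f) †)      ≈⟨ E.sym (†-∘ (e₁ ∘ f) e₂) ⟩
        ((e₁ ∘ f) ∘ e₂) †          ≈⟨ †-cong (assoc e₁ f e₂) ⟩
        (e₁ ∘ f ∘ e₂) †            ≈⟨ †-cong p ⟩
        f † ∎)
      where open SR (hs _ _)

{-# OPTIONS --safe #-}
module Submission where

-- A Moore-Penrose dagger category is Moore-Penrose complete as soon as its
-- †-idempotents split, since f f° and f° f are always †-idempotents. In
-- Split†(𝕏) a †-idempotent k on (A, e) splits through the new object (A, k).
-- And Split†(𝕏) inherits Moore-Penrose inverses from 𝕏: the identities
-- f° = f° f°† f† = f† f°† f° show that f° absorbs every idempotent that f†
-- absorbs, so f° is again a map of Split†(𝕏).

open import Defs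
open import Level using (Level; _⊔_)
open import Data.Product using (_,_; proj₁; proj₂)
open import Relation.Binary using (IsEquivalence; Setoid)
import Relation.Binary.Reasoning.Setoid as SetoidReasoning

module _ {o m e : Level} (𝔻 : DaggerCategory o m e) where
  open DaggerCategory 𝔻
  private
    module ≈ {A B : Obj} = IsEquivalence (≈-equiv {A} {B})

    homSetoid : Obj → Obj → Setoid m e
    homSetoid A B = record { Carrier = Hom A B ; _≈_ = _≈_ ; isEquivalence = ≈-equiv }

  idempotent-absorbˡ : ∀ {A B} {i : Hom A A} {j : Hom B B} {f : Hom A B} →
                       i ∘ i ≈ i → i ∘ f ∘ j ≈ f → i ∘ f ≈ f
  idempotent-absorbˡ {i = i} {j} {f} ii ifj≈f = begin
      i ∘ f                 ≈⟨ ∘-cong ≈.refl (≈.sym ifj≈f) ⟩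
      i ∘ (i ∘ f ∘ j)       ≈⟨ ≈.sym (assoc i i (f ∘ j)) ⟩
      (i ∘ i) ∘ (f ∘ j)     ≈⟨ ∘-cong ii ≈.refl ⟩
      i ∘ f ∘ j             ≈⟨ ifj≈f ⟩
      f                     ∎
    where open SetoidReasoning (homSetoid _ _)

  idempotent-absorbʳ : ∀ {A B} {i : Hom A A} {j : Hom B B} {f : Hom A B} →
                       j ∘ j ≈ j → i ∘ f ∘ j ≈ f → f ∘ j ≈ f
  idempotent-absorbʳ {i = i} {j} {f} jj ifj≈f = begin
      f ∘ j                 ≈⟨ ∘-cong (≈.sym ifj≈f) ≈.refl ⟩
      (i ∘ f ∘ j) ∘ j       ≈⟨ assoc i (f ∘ j) j ⟩
      i ∘ ((f ∘ j) ∘ j)     ≈⟨ ∘-cong ≈.refl (assoc f j j) ⟩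
      i ∘ f ∘ (j ∘ j)       ≈⟨ ∘-cong ≈.refl (∘-cong ≈.refl jj) ⟩
      i ∘ f ∘ j             ≈⟨ ifj≈f ⟩
      f                     ∎
    where open SetoidReasoning (homSetoid _ _)

  module _ {A B} {f : Hom A B} {g : Hom B A} (mpi : IsMPInverse 𝔻 f g) where
    private
      fgf≈f : f ∘ g ∘ f ≈ f
      fgf≈f = proj₁ mpi
      gfg≈g : g ∘ f ∘ g ≈ g
      gfg≈g = proj₁ (proj₂ mpi)
      fg-selfAdjoint : ((f ∘ g) †) ≈ f ∘ g
      fg-selfAdjoint = proj₁ (proj₂ (proj₂ mpi))
      gf-selfAdjoint : ((g ∘ f) †) ≈ g ∘ f
      gf-selfAdjoint = proj₂ (proj₂ (proj₂ mpi))

    mpInverse-fg-isDaggerIdempotent : IsDaggerIdempotent 𝔻 (f ∘ g)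
    mpInverse-fg-isDaggerIdempotent =
      ≈.trans (assoc f g (f ∘ g)) (∘-cong ≈.refl gfg≈g) , fg-selfAdjoint

    mpInverse-gf-isDaggerIdempotent : IsDaggerIdempotent 𝔻 (g ∘ f)
    mpInverse-gf-isDaggerIdempotent =
      ≈.trans (assoc g f (g ∘ f)) (∘-cong ≈.refl fgf≈f) , gf-selfAdjoint

    mpInverse-factorʳ : g ≈ g ∘ (g †) ∘ (f †)
    mpInverse-factorʳ = begin
      g                     ≈⟨ ≈.sym gfg≈g ⟩
      g ∘ (f ∘ g)           ≈⟨ ∘-cong ≈.refl (≈.sym fg-selfAdjoint) ⟩
      g ∘ ((f ∘ g) †)       ≈⟨ ∘-cong ≈.refl (†-∘ f g) ⟩
      g ∘ (g †) ∘ (f †)     ∎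
      where open SetoidReasoning (homSetoid _ _)

    mpInverse-factorˡ : g ≈ (f †) ∘ (g †) ∘ g
    mpInverse-factorˡ = begin
      g                     ≈⟨ ≈.sym gfg≈g ⟩
      g ∘ f ∘ g             ≈⟨ ≈.sym (assoc g f g) ⟩
      (g ∘ f) ∘ g           ≈⟨ ∘-cong (≈.sym gf-selfAdjoint) ≈.refl ⟩
      ((g ∘ f) †) ∘ g       ≈⟨ ∘-cong (†-∘ g f) ≈.refl ⟩
      ((f †) ∘ (g †)) ∘ g   ≈⟨ assoc (f †) (g †) g ⟩
      (f †) ∘ (g †) ∘ g     ∎
      where open SetoidReasoning (homSetoid _ _)

    mpInverse-absorbʳ : ∀ {i : Hom A A} → (f †) ∘ i ≈ f † → g ∘ i ≈ g
    mpInverse-absorbʳ {i} f†i≈f† = begin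
      g ∘ i                       ≈⟨ ∘-cong mpInverse-factorʳ ≈.refl ⟩
      (g ∘ (g †) ∘ (f †)) ∘ i     ≈⟨ assoc g _ i ⟩
      g ∘ ((g †) ∘ (f †)) ∘ i     ≈⟨ ∘-cong ≈.refl (assoc (g †) (f †) i) ⟩
      g ∘ (g †) ∘ (f †) ∘ i       ≈⟨ ∘-cong ≈.refl (∘-cong ≈.refl f†i≈f†) ⟩
      g ∘ (g †) ∘ (f †)           ≈⟨ ≈.sym mpInverse-factorʳ ⟩
      g                           ∎
      where open SetoidReasoning (homSetoid _ _)

    mpInverse-absorbˡ : ∀ {j : Hom B B} → j ∘ (f †) ≈ f † → j ∘ g ≈ g
    mpInverse-absorbˡ {j} jf†≈f† = begin
      j ∘ g                       ≈⟨ ∘-cong ≈.refl mpInverse-factorˡ ⟩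
      j ∘ (f †) ∘ (g †) ∘ g       ≈⟨ ≈.sym (assoc j (f †) _) ⟩
      (j ∘ (f †)) ∘ (g †) ∘ g     ≈⟨ ∘-cong jf†≈f† ≈.refl ⟩
      (f †) ∘ (g †) ∘ g           ≈⟨ ≈.sym mpInverse-factorˡ ⟩
      g                           ∎
      where open SetoidReasoning (homSetoid _ _)

  DaggerIdempotentsSplit : Set (o ⊔ m ⊔ e)
  DaggerIdempotentsSplit = ∀ {A} {i : Hom A A} → IsDaggerIdempotent 𝔻 i → DaggerSplits 𝔻 i

  moorePenrose⇒moorePenroseComplete :
    IsMoorePenrose 𝔻 → DaggerIdempotentsSplit → IsMoorePenroseComplete 𝔻
  moorePenrose⇒moorePenroseComplete mp split f =
    let (g , mpi) = mp f in
    g , mpi , split (mpInverse-fg-isDaggerIdempotent mpi)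
            , split (mpInverse-gf-isDaggerIdempotent mpi)

module _ {o m e : Level} (𝕏 : DaggerCategory o m e) where
  open DaggerCategory 𝕏
  private
    module ≈ {A B : Obj} = IsEquivalence (≈-equiv {A} {B})

  Split†-daggerIdempotentsSplit : DaggerIdempotentsSplit (Split† 𝕏)
  Split†-daggerIdempotentsSplit {A , i , ii , i†≈i} {k , iki≈k} (kk , k†≈k) =
    (A , k , kk , k†≈k) , r , ≈.sym (≈.trans (∘-cong ≈.refl k†≈k) kk)
                            , ≈.trans (∘-cong k†≈k ≈.refl) kk
    where
    r : SHom 𝕏 (A , i , ii , i†≈i) (A , k , kk , k†≈k)
    r = k , ≈.trans (∘-cong ≈.refl kk) (idempotent-absorbˡ 𝕏 ii iki≈k)

  Split†-isMoorePenrose : IsMoorePenrose 𝕏 → IsMoorePenrose (Split† 𝕏)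
  Split†-isMoorePenrose mp {A , e₁ , e₁e₁ , e₁†≈e₁} {B , e₂ , e₂e₂ , e₂†≈e₂} (f , e₁fe₂≈f) =
    (g , e₂ge₁≈g) , mpi
    where
    g : Hom B A
    g = proj₁ (mp f)
    mpi : IsMPInverse 𝕏 f g
    mpi = proj₂ (mp f)
    e₂f†e₁≈f† : e₂ ∘ (f †) ∘ e₁ ≈ f †
    e₂f†e₁≈f† = proj₂ (DaggerCategory._† (Split† 𝕏)
                  {A , e₁ , e₁e₁ , e₁†≈e₁} {B , e₂ , e₂e₂ , e₂†≈e₂} (f , e₁fe₂≈f))
    ge₁≈g : g ∘ e₁ ≈ g
    ge₁≈g = mpInverse-absorbʳ 𝕏 mpi (idempotent-absorbʳ 𝕏 e₁e₁ e₂f†e₁≈f†)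
    e₂g≈g : e₂ ∘ g ≈ g
    e₂g≈g = mpInverse-absorbˡ 𝕏 mpi (idempotent-absorbˡ 𝕏 e₂e₂ e₂f†e₁≈f†)
    e₂ge₁≈g : e₂ ∘ g ∘ e₁ ≈ g
    e₂ge₁≈g = ≈.trans (≈.sym (assoc e₂ g e₁)) (≈.trans (∘-cong e₂g≈g ≈.refl) ge₁≈g)

mainTheorem9 : ∀ {o m e : Level} (𝕏 : DaggerCategory o m e) →
    IsMoorePenrose 𝕏 → IsMoorePenroseComplete (Split† 𝕏)
-- The η-expansions are needed: otherwise the implicit objects stay unsolved.
mainTheorem9 𝕏 mp {X} {Y} =
  moorePenrose⇒moorePenroseComplete (Split† 𝕏)
    (λ {A} {B} → Split†-isMoorePenrose 𝕏 mp {A} {B})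
    (λ {A} {k} → Split†-daggerIdempotentsSplit 𝕏 {A} {k}) {X} {Y}
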